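{- If a collection $\mathcal C$ is non-uniformly generatable without repetition, then $\mathcal C$ is non-uniformly generatable with repetitions.
   Context: A language is an infinite subset of a countably infinite universe $U$; a collection is a set of languages. A generator is an arbitrary function $G$ from finite sequences in $U$ to $U$, with output $z_t=G(x_0,\dots,x_t)$; $S_t=\{x_0,\dots,x_t\}$. Non-uniform generation without repetition: for every $K\in\mathcal C$ there is $t^\star$ such that for every infinite sequence $x_0,x_1,\dots$ of pairwise distinct elements of $K$ containing every element of $K$ and every $t\ge t^\star$, $z_t\in K\setminus S_t$. Non-uniform generation with repetitions: for every $K\in\mathcal C$ there is $d^\star$ such that for every sequence $x_0,x_1,\dots$ (repetitions allowed) with $\bigcup_t\{x_t\}=K$, $z_t\in K\setminus S_t$ for all $t$ with $|S_t|\ge d^\star$. A collection has the property if some $G$ achieves it. -}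

module Defs where

open import Data.Nat using (ℕ; zero; suc; _≤_; _≥_)
open import Data.Nat.Properties using (_≟_)
open import Data.List using (List; map; upTo; length; deduplicate)
open import Data.Product using (Σ; ∃; _×_)
open import Relation.Binary.PropositionalEquality using (_≡_; _≢_)
open import Function.Definitions using (Injective)

-- Universe U: a countably infinite set, taken to be ℕ.
-- A subset of U (a candidate language) is a predicate on ℕ.
Lang : Set₁
Lang = ℕ → Set

Collection : Set₁
Collection = Lang → Set

Infinite : Lang → Set
Infinite K = ∀ n → Σ ℕ (λ m → n ≤ m × K m)

Generator : Set
Generator = List ℕ → ℕ

prefix : (ℕ → ℕ) → ℕ → List ℕ
prefix x t = map x (upTo (suc t))

InDiff : Lang → (ℕ → ℕ) → ℕ → ℕ → Set
InDiff K x t z = K z × (∀ i → i ≤ t → z ≢ x i)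

card : (ℕ → ℕ) → ℕ → ℕ
card x t = length (deduplicate _≟_ (prefix x t))

Enumeration : Lang → (ℕ → ℕ) → Set
Enumeration K x = Injective _≡_ _≡_ x × (∀ i → K (x i)) × (∀ k → K k → Σ ℕ (λ i → x i ≡ k))

RepEnumeration : Lang → (ℕ → ℕ) → Set
RepEnumeration K x = (∀ i → K (x i)) × (∀ k → K k → Σ ℕ (λ i → x i ≡ k))

NonUnifGenNoRep : Collection → Set₁
NonUnifGenNoRep C = Σ Generator λ G → ∀ K → C K → Σ ℕ λ tstar →
  ∀ x → Enumeration K x → ∀ t → t ≥ tstar → InDiff K x t (G (prefix x t))

NonUnifGenRep : Collection → Set₁
NonUnifGenRep C = Σ Generator λ G → ∀ K → C K → Σ ℕ λ dstar →
  ∀ x → RepEnumeration K x → ∀ t → card x t ≥ dstar → InDiff K x t (G (prefix x t))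

-- Feed the given generator the list of distinct elements seen so far, in order of first
-- occurrence. Along a sequence with repetitions these lists only ever grow by appending,
-- and since K is infinite they grow without bound; so they are the prefixes of a single
-- enumeration of K without repetition, and the guarantee for that enumeration at time
-- |S_t| − 1 is the required guarantee at time t.
module Submission where

open import Defs
open import Data.Nat using (ℕ; zero; suc; _+_; _≤_; _<_; _≥_; z≤n; s≤s; pred; >-nonZero)
open import Data.Nat.Properties
  using (_≟_; suc-pred; ≤-total; ≤-refl; ≤-trans; <-≤-trans; ≤-<-trans; m≤m+n; m≤n+m; n≮n; pred-mono-≤)
open import Data.Nat.ListAction using (sum)
open import Data.List using (List; []; _∷_; applyUpTo; length; deduplicate)
open import Data.List.Properties using (map-upTo)
open import Data.List.Membership.Propositional using (_∈_; _∉_)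
open import Data.List.Membership.Propositional.Properties
  using (∈-applyUpTo⁺; ∈-applyUpTo⁻; ∈-deduplicate⁺; ∈-deduplicate⁻; ∈-length)
open import Data.List.Relation.Unary.Any using (here; there)
open import Data.List.Relation.Unary.All using (All; _∷_)
open import Data.List.Relation.Unary.AllPairs using (_∷_)
open import Data.List.Relation.Unary.Unique.Propositional using (Unique)
open import Data.List.Relation.Unary.Unique.DecPropositional.Properties using (deduplicate-!)
open import Data.List.Relation.Binary.Prefix.Heterogeneous using (Prefix; []; _∷_)
open import Data.List.Relation.Binary.Prefix.Heterogeneous.Properties using (length-mono; filter⁺)
open import Data.Product using (Σ; ∃-syntax; _×_; _,_; proj₁; proj₂)
open import Data.Sum using (inj₁; inj₂)
open import Relation.Nullary using (contradiction)
open import Relation.Binary.PropositionalEquality using (_≡_; _≢_; refl; sym; trans; cong; cong₂; subst; subst₂)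

_⊑_ : List ℕ → List ℕ → Set
_⊑_ = Prefix _≡_

dedup : List ℕ → List ℕ
dedup = deduplicate _≟_

∈⇒≤sum : ∀ {n ns} → n ∈ ns → n ≤ sum ns
∈⇒≤sum {ns = m ∷ ns} (here refl) = m≤m+n m (sum ns)
∈⇒≤sum {ns = m ∷ ns} (there n∈ns) = ≤-trans (∈⇒≤sum n∈ns) (m≤n+m (sum ns) m)

applyUpTo-⊑ : ∀ (f : ℕ → ℕ) {m n} → m ≤ n → applyUpTo f m ⊑ applyUpTo f n
applyUpTo-⊑ f z≤n = []
applyUpTo-⊑ f (s≤s m≤n) = refl ∷ applyUpTo-⊑ (λ i → f (suc i)) m≤n

dedup-⊑ : ∀ {xs ys} → xs ⊑ ys → dedup xs ⊑ dedup ys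
dedup-⊑ [] = []
dedup-⊑ (refl ∷ xs⊑ys) = refl ∷ filter⁺ _ _ (λ { refl p → p }) (λ { refl p → p }) (dedup-⊑ xs⊑ys)

⊑-new-element-length : ∀ {xs ys y} → xs ⊑ ys → y ∈ ys → y ∉ xs → length xs < length ys
⊑-new-element-length [] y∈ys _ = ∈-length y∈ys
⊑-new-element-length (refl ∷ _) (here refl) y∉xs = contradiction (here refl) y∉xs
⊑-new-element-length (refl ∷ xs⊑ys) (there y∈ys) y∉xs =
  s≤s (⊑-new-element-length xs⊑ys y∈ys (λ y∈xs → y∉xs (there y∈xs)))

-- Indexing with the junk value 0 past the end; every use below is guarded by n < length xs.
nth : List ℕ → ℕ → ℕ
nth [] n = 0
nth (x ∷ xs) zero = x
nth (x ∷ xs) (suc n) = nth xs n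

nth-⊑ : ∀ {xs ys n} → xs ⊑ ys → n < length xs → nth xs n ≡ nth ys n
nth-⊑ {n = zero} (refl ∷ _) _ = refl
nth-⊑ {n = suc n} (refl ∷ xs⊑ys) (s≤s n<len) = nth-⊑ xs⊑ys n<len

nth-∈ : ∀ xs {n} → n < length xs → nth xs n ∈ xs
nth-∈ (x ∷ xs) {zero} _ = here refl
nth-∈ (x ∷ xs) {suc n} (s≤s n<len) = there (nth-∈ xs n<len)

∈⇒nth : ∀ {y} xs → y ∈ xs → ∃[ n ] n < length xs × nth xs n ≡ y
∈⇒nth (x ∷ xs) (here refl) = zero , s≤s z≤n , refl
∈⇒nth (x ∷ xs) (there y∈xs) with ∈⇒nth xs y∈xs
... | n , n<len , eq = suc n , s≤s n<len , eq

nth-∉-tail : ∀ {x} xs {n} → All (x ≢_) xs → n < length xs → x ≢ nth xs n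
nth-∉-tail (y ∷ xs) {zero} (x≢y ∷ _) _ = x≢y
nth-∉-tail (y ∷ xs) {suc n} (_ ∷ x∉xs) (s≤s n<len) = nth-∉-tail xs x∉xs n<len

nth-injective : ∀ {xs m n} → Unique xs → m < length xs → n < length xs →
  nth xs m ≡ nth xs n → m ≡ n
nth-injective {_ ∷ _} {zero} {zero} _ _ _ _ = refl
nth-injective {_ ∷ xs} {zero} {suc n} (x∉xs ∷ _) _ (s≤s n<len) eq =
  contradiction eq (nth-∉-tail xs x∉xs n<len)
nth-injective {_ ∷ xs} {suc m} {zero} (x∉xs ∷ _) (s≤s m<len) _ eq =
  contradiction (sym eq) (nth-∉-tail xs x∉xs m<len)
nth-injective {_ ∷ _} {suc m} {suc n} (_ ∷ u) (s≤s m<len) (s≤s n<len) eq =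
  cong suc (nth-injective u m<len n<len eq)

applyUpTo-nth : ∀ xs (f : ℕ → ℕ) → (∀ {n} → n < length xs → f n ≡ nth xs n) →
  applyUpTo f (length xs) ≡ xs
applyUpTo-nth [] f f≡nth = refl
applyUpTo-nth (x ∷ xs) f f≡nth =
  cong₂ _∷_ (f≡nth (s≤s z≤n)) (applyUpTo-nth xs (λ n → f (suc n)) (λ n<len → f≡nth (s≤s n<len)))

module Limit (D : ℕ → List ℕ) (D-mono : ∀ {s t} → s ≤ t → D s ⊑ D t)
             (D-unbounded : ∀ n → ∃[ t ] n < length (D t)) where

  limit : ℕ → ℕ
  limit n = nth (D (proj₁ (D-unbounded n))) n

  nth≡limit : ∀ t {n} → n < length (D t) → nth (D t) n ≡ limit n
  nth≡limit t {n} n<len with D-unbounded n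
  ... | s , n<len′ with ≤-total s t
  ... | inj₁ s≤t = sym (nth-⊑ (D-mono s≤t) n<len′)
  ... | inj₂ t≤s = nth-⊑ (D-mono t≤s) n<len

  <-length-mono : ∀ {n s t} → s ≤ t → n < length (D s) → n < length (D t)
  <-length-mono s≤t n<len = <-≤-trans n<len (length-mono (D-mono s≤t))

  limit-∈ : ∀ n → ∃[ t ] limit n ∈ D t
  limit-∈ n = proj₁ (D-unbounded n) , nth-∈ (D _) (proj₂ (D-unbounded n))

  ∈⇒limit : ∀ t {y} → y ∈ D t → ∃[ n ] n < length (D t) × limit n ≡ y
  ∈⇒limit t y∈D with ∈⇒nth (D t) y∈D
  ... | n , n<len , nth≡y = n , n<len , trans (sym (nth≡limit t n<len)) nth≡y

  limit-injective : (∀ t → Unique (D t)) → ∀ {m n} → limit m ≡ limit n → m ≡ n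
  limit-injective unique {m} {n} eq =
    nth-injective (unique t) m<len n<len
      (trans (nth≡limit t m<len) (trans eq (sym (nth≡limit t n<len))))
    where
      s₁ = proj₁ (D-unbounded m)
      s₂ = proj₁ (D-unbounded n)
      t = s₁ + s₂
      m<len = <-length-mono (m≤m+n s₁ s₂) (proj₂ (D-unbounded m))
      n<len = <-length-mono (m≤n+m s₂ s₁) (proj₂ (D-unbounded n))

  applyUpTo-limit : ∀ t → applyUpTo limit (length (D t)) ≡ D t
  applyUpTo-limit t = applyUpTo-nth (D t) limit (λ n<len → sym (nth≡limit t n<len))

distinctPrefix : (ℕ → ℕ) → ℕ → List ℕ
distinctPrefix x t = dedup (prefix x t)

module _ (x : ℕ → ℕ) where

  prefix≡applyUpTo : ∀ t → prefix x t ≡ applyUpTo x (suc t)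
  prefix≡applyUpTo t = map-upTo x (suc t)

  distinctPrefix-⊑ : ∀ {s t} → s ≤ t → distinctPrefix x s ⊑ distinctPrefix x t
  distinctPrefix-⊑ {s} {t} s≤t =
    dedup-⊑ (subst₂ _⊑_ (sym (prefix≡applyUpTo s)) (sym (prefix≡applyUpTo t))
                        (applyUpTo-⊑ x (s≤s s≤t)))

  ∈-distinctPrefix : ∀ {i t} → i ≤ t → x i ∈ distinctPrefix x t
  ∈-distinctPrefix {i} {t} i≤t =
    ∈-deduplicate⁺ _≟_ (subst (x i ∈_) (sym (prefix≡applyUpTo t)) (∈-applyUpTo⁺ x (s≤s i≤t)))

  distinctPrefix-⊆ : ∀ {t y} → y ∈ distinctPrefix x t → ∃[ i ] i ≤ t × y ≡ x i
  distinctPrefix-⊆ {t} {y} y∈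
    with ∈-applyUpTo⁻ x (subst (y ∈_) (prefix≡applyUpTo t) (∈-deduplicate⁻ _≟_ (prefix x t) y∈))
  ... | i , s≤s i≤t , y≡xi = i , i≤t , y≡xi

  -- An element of K exceeding the sum of the distinct elements seen so far is not among them.
  distinctPrefix-unbounded : ∀ {K} → Infinite K → (∀ k → K k → ∃[ i ] x i ≡ k) →
    ∀ n → ∃[ t ] n < length (distinctPrefix x t)
  distinctPrefix-unbounded inf onto zero = 0 , ∈-length (∈-distinctPrefix {0} ≤-refl)
  distinctPrefix-unbounded inf onto (suc n) with distinctPrefix-unbounded inf onto n
  ... | t , n<len with inf (suc (sum (distinctPrefix x t)))
  ... | m , sum<m , Km with onto m Km
  ... | i , refl =
    t + i , ≤-<-trans n<len
      (⊑-new-element-length (distinctPrefix-⊑ (m≤m+n t i)) (∈-distinctPrefix (m≤n+m i t))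
        (λ xi∈ → n≮n _ (≤-trans sum<m (∈⇒≤sum xi∈))))

module FirstOccurrences {K : Lang} (infinite : Infinite K) (x : ℕ → ℕ) (x-enum : RepEnumeration K x) where

  open Limit (distinctPrefix x) (distinctPrefix-⊑ x)
             (distinctPrefix-unbounded x infinite (proj₂ x-enum)) public

  limit-∈K : ∀ n → K (limit n)
  limit-∈K n with limit-∈ n
  ... | t , limit∈D with distinctPrefix-⊆ x {t} limit∈D
  ... | i , _ , limit≡xi = subst K (sym limit≡xi) (proj₁ x-enum i)

  limit-onto : ∀ k → K k → ∃[ n ] limit n ≡ k
  limit-onto k Kk with proj₂ x-enum k Kk
  ... | i , refl with ∈⇒limit i (∈-distinctPrefix x ≤-refl)
  ... | n , _ , limit≡xi = n , limit≡xi

  limit-enumeration : Enumeration K limit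
  limit-enumeration = limit-injective (λ t → deduplicate-! _≟_ (prefix x t)) , limit-∈K , limit-onto

  prefix-limit : ∀ t → prefix limit (pred (card x t)) ≡ distinctPrefix x t
  prefix-limit t =
    trans (prefix≡applyUpTo limit (pred (card x t)))
      (trans (cong (applyUpTo limit) (suc-pred (card x t) {{>-nonZero 0<card}})) (applyUpTo-limit t))
    where
      0<card : 0 < card x t
      0<card = ∈-length (∈-distinctPrefix x {t} ≤-refl)

  InDiff-limit⇒InDiff : ∀ t {z} → InDiff K limit (pred (card x t)) z → InDiff K x t z
  InDiff-limit⇒InDiff t (Kz , z∉limit) = Kz , λ i i≤t z≡xi →
    let (n , n<card , limit≡xi) = ∈⇒limit t (∈-distinctPrefix x i≤t)
    in z∉limit n (pred-mono-≤ n<card) (trans z≡xi (sym limit≡xi))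

lemmaA2 : (C : Collection) → (∀ K → C K → Infinite K) →
    NonUnifGenNoRep C → NonUnifGenRep C
lemmaA2 C infinite (G , G-generates) = (λ xs → G (dedup xs)) , generates
  where
    generates : ∀ K → C K → Σ ℕ λ d⋆ → ∀ x → RepEnumeration K x → ∀ t → card x t ≥ d⋆ →
      InDiff K x t (G (dedup (prefix x t)))
    generates K K∈C with G-generates K K∈C
    ... | t⋆ , works = suc t⋆ , λ x x-enum t t⋆<card →
      let open FirstOccurrences (infinite K K∈C) x x-enum
          limit-works = works limit limit-enumeration (pred (card x t)) (pred-mono-≤ t⋆<card)
      in InDiff-limit⇒InDiff t
           (subst (λ xs → InDiff K limit (pred (card x t)) (G xs)) (prefix-limit t) limit-works)
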